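{- Let $D$ be a finite acyclic digraph and let $\overline{D}$ be its complement. Then the number of Hamiltonian paths on $\overline{D}$ is equal to the number of cycle covers of $\overline{D}$.
   Context: A digraph consists of a finite vertex set $V$ and an arrow set which is a subset of $V\times V$; loops $(v,v)$ are allowed but multiple arrows are not. The complement $\overline{D}$ has vertex set $V$ and contains an arrow $e\in V\times V$ (loops included) if and only if $D$ does not contain $e$. A path (resp. cycle) on $D$ is a subdigraph of $D$ that is a directed path (resp. directed cycle) never using a vertex twice; a path may be a single vertex, and a cycle may be a single loop. $D$ is acyclic if there are no cycles on $D$ (in particular no loops). A Hamiltonian path is a path passing through every vertex. A cycle cover of $D$ is a spanning subdigraph of $D$ (same vertex set) that is a disjoint union of cycles on $D$ such that every vertex lies in exactly one cycle. -}

module Defs where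

open import Data.Bool using (Bool; not; T)
open import Data.Nat using (ℕ; zero; suc)
open import Data.Fin using (Fin)
open import Data.Fin.Properties using (all?) renaming (_≟_ to _≟ᶠ_)
open import Data.List using (allFin; List; []; _∷_; _++_; [_]; length; filter; concatMap; map)
open import Data.Vec using (Vec; lookup; toList) renaming (_∷_ to _∷ᵥ_; [] to []ᵥ)
open import Data.List.Relation.Unary.Linked using (Linked; linked?)
open import Data.List.Relation.Unary.Unique.Propositional using (Unique)
import Data.List.Relation.Unary.Unique.DecPropositional as UDec
open import Data.Nat.Properties using () renaming (_≟_ to _≟ℕ_)
open import Data.Product using (_×_)
open import Data.Bool.Properties using (T?)
open import Relation.Nullary using (¬_; Dec)
open import Relation.Nullary.Decidable using (_×-dec_)
open import Relation.Binary.PropositionalEquality using (_≡_)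

-- A digraph on the finite vertex set Fin n: the arrow set is a subset of
-- Fin n × Fin n, given by its (Boolean) indicator.  Loops allowed.
record Digraph (n : ℕ) : Set where
  constructor digraph
  field
    arrow : Fin n → Fin n → Bool

open Digraph public

Arrow : ∀ {n} → Digraph n → Fin n → Fin n → Set
Arrow D u v = T (arrow D u v)

complement : ∀ {n} → Digraph n → Digraph n
complement D = digraph (λ u v → not (arrow D u v))

-- A cycle on D, listed as its distinct vertices x ∷ xs in order:
-- x → x₁ → … → xₖ → x.  (A one-vertex cycle is a loop.)
IsCycle : ∀ {n} → Digraph n → Fin n → List (Fin n) → Set
IsCycle D x xs = Unique (x ∷ xs) × Linked (Arrow D) (x ∷ xs ++ [ x ])

Acyclic : ∀ {n} → Digraph n → Set
Acyclic D = ∀ x xs → ¬ IsCycle D x xs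

IsHamiltonianPath : ∀ {n} → Digraph n → List (Fin n) → Set
IsHamiltonianPath {n} D xs = length xs ≡ n × Unique xs × Linked (Arrow D) xs

-- A cycle cover of D, encoded by its successor table σ (σ[v] = the vertex
-- following v on its cycle): σ is a permutation of the vertices and every
-- v → σ[v] is an arrow of D.  Cycle covers correspond bijectively to such σ.
IsCycleCover : ∀ {n} → Digraph n → Vec (Fin n) n → Set
IsCycleCover D σ = Unique (toList σ) × (∀ v → Arrow D v (lookup σ v))

isHamiltonianPath? : ∀ {n} (D : Digraph n) (xs : List (Fin n)) → Dec (IsHamiltonianPath D xs)
isHamiltonianPath? {n} D xs =
  (length xs ≟ℕ n) ×-dec (UDec.unique? (_≟ᶠ_ {n}) xs ×-dec linked? (λ u v → T? (arrow D u v)) xs)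

isCycleCover? : ∀ {n} (D : Digraph n) (σ : Vec (Fin n) n) → Dec (IsCycleCover D σ)
isCycleCover? {n} D σ = UDec.unique? (_≟ᶠ_ {n}) (toList σ) ×-dec all? (λ v → T? (arrow D v (lookup σ v)))

allFins : (n : ℕ) → List (Fin n)
allFins n = allFin n

allVecs : (n k : ℕ) → List (Vec (Fin n) k)
allVecs n zero    = []ᵥ ∷ []
allVecs n (suc k) = concatMap (λ v → map (v ∷ᵥ_) (allVecs n k)) (allFins n)

-- Number of Hamiltonian paths on D (a Hamiltonian path has exactly n
-- vertices, so it suffices to enumerate vertex sequences of length n).
numHamiltonianPaths : ∀ {n} → Digraph n → ℕ
numHamiltonianPaths {n} D = length (filter (isHamiltonianPath? D) (map toList (allVecs n n)))

numCycleCovers : ∀ {n} → Digraph n → ℕ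
numCycleCovers {n} D = length (filter (isCycleCover? D) (allVecs n n))

{-# OPTIONS --safe #-}
-- A Foata-style bijection. Let xs = A ++ m ∷ B be a Hamiltonian path of the complement of D, where m is
-- a source of D restricted to the vertices of xs (it exists as D is acyclic, and is chosen canonically,
-- depending only on that vertex set). No vertex has a D-arrow into m, so closing m ∷ B into a cycle only
-- uses arrows of the complement; recursing on A (loops are complement arrows too) yields a cycle cover.
-- Conversely a cycle cover determines m, its cycle through m determines B, and the remaining cycles
-- determine A by induction, so the construction is a bijection.
module Submission where

open import Defs
open import Data.Bool using (true; false; if_then_else_)
open import Data.Bool.Properties using (T?)
open import Data.Empty using (⊥; ⊥-elim)
open import Data.Fin using (Fin)
import Data.Fin as Fin
open import Data.Fin.Properties using () renaming (_≟_ to _≟ᶠ_)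
open import Data.List
  using (List; []; _∷_; _++_; [_]; _∷ʳ_; length; filter; map; head; allFin; concatMap; cartesianProductWith)
import Data.List as List
open import Data.List.Membership.Propositional using (_∈_; _∉_; find; lose)
open import Data.List.Membership.Propositional.Properties
  using ( ∈-filter⁺; ∈-filter⁻; ∈-map⁺; ∈-map⁻; ∈-++⁺ˡ; ∈-++⁺ʳ; ∈-++⁻; ∈-∃++; ∈-allFin
        ; ∈-cartesianProductWith⁺)
open import Data.List.Membership.Propositional.Properties.WithK using (unique∧set⇒bag)
open import Data.List.Properties
  using ( length-filter; length-tabulate; length-map; length-++-≤ˡ; length-++-sucʳ; filter-notAll; filter-≐
        ; ++-assoc)
open import Data.List.Relation.Binary.BagAndSetEquality using (_∼[_]_; set; ∼bag⇒↭)
open import Data.List.Relation.Binary.Disjoint.Propositional using (Disjoint)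
open import Data.List.Relation.Binary.Permutation.Propositional.Properties using (↭-length; ∈-resp-↭; ∷↭∷ʳ)
open import Data.List.Relation.Binary.Subset.Propositional.Properties using (⊆[]⇒≡[])
open import Data.List.Relation.Unary.All as All using (All; []; _∷_; all?)
import Data.List.Relation.Unary.All.Properties as All
open import Data.List.Relation.Unary.All.Properties using (¬Any⇒All¬)
open import Data.List.Relation.Unary.Any as Any using (Any; here; there; any?)
open import Data.List.Relation.Unary.AllPairs as AllPairs using ([]; _∷_)
open import Data.List.Relation.Unary.Linked as Linked using (Linked; []; [-]; _∷_)
open import Data.List.Relation.Unary.Unique.Propositional using (Unique)
open import Data.List.Relation.Unary.Unique.Propositional.Properties as Unique
  using (filter⁺; allFin⁺; tabulate⁺; cartesianProductWith⁺; Unique[x∷xs]⇒x∉xs)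
open import Data.Maybe using (Maybe; just; nothing; maybe)
open import Data.Maybe.Properties using (just-injective)
open import Data.Nat using (ℕ; zero; suc; _+_; _≤_; _<_; z≤n; s≤s)
open import Data.Nat.Properties
  using (≤-refl; ≤-trans; ≤-pred; <-irrefl; <⇒≱; ≤-reflexive; +-suc; +-monoʳ-≤; m≤m+n; module ≤-Reasoning)
open import Data.Product using (∃; ∃₂; _×_; _,_; proj₁; proj₂)
import Data.Product as Product
open import Data.Sum using (_⊎_; inj₁; inj₂)
open import Data.Vec using (Vec; lookup; toList; fromList; tabulate) renaming (_∷_ to _∷ᵥ_; [] to []ᵥ)
open import Data.Vec.Properties
  using (∷-injective; lookup∘tabulate; tabulate∘lookup; tabulate-cong; toList-injective; toList∘fromList)
open import Data.Vec.Relation.Binary.Equality.Cast using (cast-is-id)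
open import Function using (_∘_; id)
open import Function.Bundles using (mk⇔; Equivalence)
open import Relation.Binary.Definitions using (DecidableEquality)
open import Relation.Binary.PropositionalEquality
  using (_≡_; _≢_; refl; sym; trans; cong; cong₂; subst; module ≡-Reasoning)
open import Relation.Nullary using (¬_; Dec; yes; no; ¬?; does)
open import Relation.Nullary.Decidable using (_×-dec_)
open import Relation.Unary using (Decidable)

module _ {A : Set} where

  unique∧set⇒length≡ : ∀ {xs ys : List A} → Unique xs → Unique ys → xs ∼[ set ] ys →
                       length xs ≡ length ys
  unique∧set⇒length≡ xs! ys! xs≈ys = ↭-length (∼bag⇒↭ (unique∧set⇒bag xs! ys! xs≈ys))

  unique-++⁻ˡ : ∀ xs {ys : List A} → Unique (xs ++ ys) → Unique xs
  unique-++⁻ˡ []       _          = []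
  unique-++⁻ˡ (x ∷ xs) (x∉ ∷ xs!) = All.++⁻ˡ xs x∉ ∷ unique-++⁻ˡ xs xs!

  unique-++⁻ʳ : ∀ xs {ys : List A} → Unique (xs ++ ys) → Unique ys
  unique-++⁻ʳ []       ys!       = ys!
  unique-++⁻ʳ (x ∷ xs) (_ ∷ xs!) = unique-++⁻ʳ xs xs!

  unique-++⇒disjoint : ∀ xs {ys : List A} → Unique (xs ++ ys) → Disjoint xs ys
  unique-++⇒disjoint (x ∷ xs) (x∉ ∷ _)   (here refl , y∈) = All.lookup (All.++⁻ʳ xs x∉) y∈ refl
  unique-++⇒disjoint (x ∷ xs) (_  ∷ xs!) (there x∈  , y∈) = unique-++⇒disjoint xs xs! (x∈ , y∈)

  unique-∷ʳ⁺ : ∀ {xs : List A} {x} → Unique xs → x ∉ xs → Unique (xs ∷ʳ x)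
  unique-∷ʳ⁺ xs! x∉ = Unique.++⁺ xs! ([] ∷ []) (λ { (x∈ , here refl) → x∉ x∈ })

  map-injectiveOn⇒unique : ∀ {B : Set} (f : A → B) {xs} → Unique xs →
                (∀ {x y} → x ∈ xs → y ∈ xs → f x ≡ f y → x ≡ y) → Unique (map f xs)
  map-injectiveOn⇒unique f {[]}     []         _   = []
  map-injectiveOn⇒unique f {x ∷ xs} (x∉ ∷ xs!) inj =
    All.tabulate (λ fy∈ fx≡ → let y , y∈ , fy≡ = ∈-map⁻ f fy∈ in
                   All.lookup x∉ y∈ (inj (here refl) (there y∈) (trans fx≡ fy≡)))
    ∷ map-injectiveOn⇒unique f xs! (λ p q → inj (there p) (there q))

  unique-map⇒injectiveOn : ∀ {B : Set} (f : A → B) {xs} → Unique (map f xs) →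
                ∀ {x y} → x ∈ xs → y ∈ xs → f x ≡ f y → x ≡ y
  unique-map⇒injectiveOn f {z ∷ zs} _          (here refl) (here refl) _   = refl
  unique-map⇒injectiveOn f {z ∷ zs} (fz∉ ∷ _)  (here refl) (there y∈)  fz≡ =
    ⊥-elim (All.lookup fz∉ (∈-map⁺ f y∈) fz≡)
  unique-map⇒injectiveOn f {z ∷ zs} (fz∉ ∷ _)  (there x∈)  (here refl) fx≡ =
    ⊥-elim (All.lookup fz∉ (∈-map⁺ f x∈) (sym fx≡))
  unique-map⇒injectiveOn f {z ∷ zs} (_ ∷ fzs!) (there x∈)  (there y∈)  fx≡ =
    unique-map⇒injectiveOn f fzs! x∈ y∈ fx≡

  length<length-++-∷ : ∀ xs {y} {ys : List A} → length xs < length (xs ++ y ∷ ys)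
  length<length-++-∷ xs {y} {ys} =
    subst (length xs <_) (sym (length-++-sucʳ xs y ys)) (s≤s (length-++-≤ˡ xs))

  ∼set-++-cancelʳ : ∀ {xs xs′ zs : List A} → Disjoint xs zs → Disjoint xs′ zs →
                    (xs ++ zs) ∼[ set ] (xs′ ++ zs) → xs ∼[ set ] xs′
  ∼set-++-cancelʳ {zs = zs} xs#zs xs′#zs xs≈xs′ =
    mk⇔ (cancel xs#zs (Equivalence.to xs≈xs′)) (cancel xs′#zs (Equivalence.from xs≈xs′))
    where
    cancel : ∀ {as bs} → Disjoint as zs → (∀ {x} → x ∈ as ++ zs → x ∈ bs ++ zs) → ∀ {x} → x ∈ as → x ∈ bs
    cancel {as} {bs} as#zs to x∈ with ∈-++⁻ bs (to (∈-++⁺ˡ x∈))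
    ... | inj₁ x∈bs = x∈bs
    ... | inj₂ x∈zs = ⊥-elim (as#zs (x∈ , x∈zs))

module _ {A : Set} {R : A → A → Set} where

  Linked-++⁻ˡ : ∀ xs {ys} → Linked R (xs ++ ys) → Linked R xs
  Linked-++⁻ˡ []           _       = []
  Linked-++⁻ˡ (x ∷ [])     _       = [-]
  Linked-++⁻ˡ (x ∷ y ∷ xs) (r ∷ l) = r ∷ Linked-++⁻ˡ (y ∷ xs) l

  Linked-++⁻ʳ : ∀ xs {ys} → Linked R (xs ++ ys) → Linked R ys
  Linked-++⁻ʳ []       l = l
  Linked-++⁻ʳ (x ∷ xs) l = Linked-++⁻ʳ xs (Linked.tail l)

  Linked-∷ʳ⁺ : ∀ xs {x y} → Linked R (xs ∷ʳ x) → R x y → Linked R (xs ∷ʳ x ∷ʳ y)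
  Linked-∷ʳ⁺ []           _        r = r ∷ [-]
  Linked-∷ʳ⁺ (x ∷ [])     (r′ ∷ _) r = r′ ∷ r ∷ [-]
  Linked-∷ʳ⁺ (x ∷ y ∷ xs) (r′ ∷ l) r = r′ ∷ Linked-∷ʳ⁺ (y ∷ xs) l r

  Linked-++-All⁺ : ∀ {xs y ys} → Linked R xs → All (λ x → R x y) xs → Linked R (y ∷ ys) →
                   Linked R (xs ++ y ∷ ys)
  Linked-++-All⁺ []      []       l = l
  Linked-++-All⁺ [-]     (r ∷ []) l = r ∷ l
  Linked-++-All⁺ (r ∷ k) (_ ∷ rs) l = r ∷ Linked-++-All⁺ k rs l

module _ {A B : Set} {P : A → Set} {Q : B → Set} (P? : Decidable P) (Q? : Decidable Q) where

  bijection⇒length-filter≡ :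
    (f : A → B) {xs : List A} {ys : List B} → Unique xs → Unique ys →
    (∀ {x} → P x → x ∈ xs) → (∀ {y} → Q y → y ∈ ys) →
    (∀ {x} → P x → Q (f x)) → (∀ {x y} → P x → P y → f x ≡ f y → x ≡ y) →
    (∀ {y} → Q y → ∃ λ x → P x × f x ≡ y) →
    length (filter P? xs) ≡ length (filter Q? ys)
  bijection⇒length-filter≡ f {xs} {ys} xs! ys! xs-complete ys-complete f-into f-injective f-onto = begin
    length (filter P? xs)           ≡⟨ length-map f (filter P? xs) ⟨
    length (map f (filter P? xs))   ≡⟨ unique∧set⇒length≡ image! (filter⁺ Q? ys!) (mk⇔ to from) ⟩
    length (filter Q? ys)           ∎
    where
    open ≡-Reasoning
    P-of : ∀ {x} → x ∈ filter P? xs → P x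
    P-of x∈ = proj₂ (∈-filter⁻ P? {xs = xs} x∈)
    image! : Unique (map f (filter P? xs))
    image! = map-injectiveOn⇒unique f (filter⁺ P? xs!) (λ x∈ y∈ → f-injective (P-of x∈) (P-of y∈))
    to : ∀ {y} → y ∈ map f (filter P? xs) → y ∈ filter Q? ys
    to y∈ with ∈-map⁻ f y∈
    ... | x , x∈ , refl = ∈-filter⁺ Q? (ys-complete (f-into (P-of x∈))) (f-into (P-of x∈))
    from : ∀ {y} → y ∈ filter Q? ys → y ∈ map f (filter P? xs)
    from y∈ with f-onto (proj₂ (∈-filter⁻ Q? {xs = ys} y∈))
    ... | x , px , refl = ∈-map⁺ f (∈-filter⁺ P? (xs-complete px) px)

Iterates : {A : Set} → (A → A) → List A → Set
Iterates σ = Linked (λ x y → σ x ≡ y)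

IsCycleOf : {A : Set} → (A → A) → A → List A → Set
IsCycleOf σ m B = Unique (m ∷ B) × Iterates σ (m ∷ B ∷ʳ m)

headOr : {A : Set} → A → List A → A
headOr d []      = d
headOr d (x ∷ _) = x

headOr-∈ : {A : Set} (d : A) (xs : List A) → headOr d xs ∈ d ∷ xs
headOr-∈ d []      = here refl
headOr-∈ d (x ∷ _) = there (here refl)

lastOr : {A : Set} → A → List A → A
lastOr d []       = d
lastOr d (x ∷ xs) = lastOr x xs

lastOr-∈ : {A : Set} (d : A) (xs : List A) → lastOr d xs ∈ d ∷ xs
lastOr-∈ d []       = here refl
lastOr-∈ d (x ∷ xs) = there (lastOr-∈ x xs)

module _ {A : Set} {σ : A → A} where

  iterates-cong : ∀ {τ : A → A} → (∀ x → σ x ≡ τ x) → ∀ {xs} → Iterates σ xs → Iterates τ xs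
  iterates-cong σ≗τ = Linked.map (λ {x} σx≡y → trans (sym (σ≗τ x)) σx≡y)

  iterates⇒related : ∀ {R : A → A → Set} xs {y} → Linked R (xs ∷ʳ y) → Iterates σ (xs ∷ʳ y) →
                     ∀ {x} → x ∈ xs → R x (σ x)
  iterates⇒related {R} (x ∷ [])     (r ∷ _) (σx≡ ∷ _) (here refl) = subst (R x) (sym σx≡) r
  iterates⇒related {R} (x ∷ z ∷ xs) (r ∷ _) (σx≡ ∷ _) (here refl) = subst (R x) (sym σx≡) r
  iterates⇒related     (x ∷ z ∷ xs) (_ ∷ l) (_ ∷ it)  (there x∈)  = iterates⇒related (z ∷ xs) l it x∈

  map-iterates : ∀ x xs {y} → Iterates σ (x ∷ xs ∷ʳ y) → map σ (x ∷ xs) ≡ xs ∷ʳ y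
  map-iterates x []       (σx≡ ∷ _)  = cong [_] σx≡
  map-iterates x (z ∷ xs) (σx≡ ∷ it) = cong₂ _∷_ σx≡ (map-iterates z xs it)

  iterates-closed : ∀ {S : List A} → (∀ {x} → x ∈ S → σ x ∈ S) →
                    ∀ {x xs} → x ∈ S → Iterates σ (x ∷ xs) → All (_∈ S) (x ∷ xs)
  iterates-closed closed x∈ [-]        = x∈ ∷ []
  iterates-closed closed x∈ (σx≡ ∷ it) = x∈ ∷ iterates-closed closed (subst (_∈ _) σx≡ (closed x∈)) it

  iterates-∷ʳ⁺ : ∀ {x} xs → Iterates σ (x ∷ xs) → Iterates σ (x ∷ xs ∷ʳ σ (lastOr x xs))
  iterates-∷ʳ⁺ []       [-]        = refl ∷ [-]
  iterates-∷ʳ⁺ (z ∷ xs) (σx≡ ∷ it) = σx≡ ∷ iterates-∷ʳ⁺ xs it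

  iterates-unique : ∀ {y} x xs xs′ → Iterates σ (x ∷ xs ∷ʳ y) → Iterates σ (x ∷ xs′ ∷ʳ y) →
                    y ∉ xs → y ∉ xs′ → xs ≡ xs′
  iterates-unique x []       []         _          _           _  _   = refl
  iterates-unique x []       (z ∷ xs′)  (σx≡ ∷ _)  (σx≡′ ∷ _)  _  y∉′ = ⊥-elim (y∉′ (here (trans (sym σx≡) σx≡′)))
  iterates-unique x (z ∷ xs) []         (σx≡ ∷ _)  (σx≡′ ∷ _)  y∉ _   = ⊥-elim (y∉ (here (trans (sym σx≡′) σx≡)))
  iterates-unique x (z ∷ xs) (z′ ∷ xs′) (σx≡ ∷ it) (σx≡′ ∷ it′) y∉ y∉′ with trans (sym σx≡) σx≡′
  ... | refl = cong (z ∷_) (iterates-unique z xs xs′ it it′ (y∉ ∘ there) (y∉′ ∘ there))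

  module _ (σ-injective : ∀ {x y} → σ x ≡ σ y → x ≡ y) where

    iterates-last-successor∉ : ∀ x xs → Unique (x ∷ xs) → Iterates σ (x ∷ xs) → σ (lastOr x xs) ∉ xs
    iterates-last-successor∉ x (z ∷ xs) (x∉ ∷ _) (σx≡ ∷ _) (here σlast≡z) =
      All.lookup x∉ (lastOr-∈ z xs) (sym (σ-injective (trans σlast≡z (sym σx≡))))
    iterates-last-successor∉ x (z ∷ xs) (_ ∷ zxs!) (_ ∷ it) (there σlast∈) =
      iterates-last-successor∉ z xs zxs! it σlast∈

    cycle-preimage : ∀ {m B} → IsCycleOf σ m B → ∀ {x} → σ x ∈ m ∷ B → x ∈ m ∷ B
    cycle-preimage {m} {B} (_ , it) {x} σx∈
      with ∈-map⁻ σ (subst (σ x ∈_) (sym (map-iterates m B it)) (∈-resp-↭ (∷↭∷ʳ m B) σx∈))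
    ... | z , z∈ , σx≡σz = subst (_∈ m ∷ B) (sym (σ-injective σx≡σz)) z∈

module CycleSuccessor {A : Set} (_≟_ : DecidableEquality A) where

  open import Data.List.Membership.DecPropositional _≟_ using (_∈?_)

  next : A → List A → A → A
  next h []       x = h
  next h (y ∷ ys) x = if does (x ≟ y) then headOr h ys else next h ys x

  next-head : ∀ h y ys → next h (y ∷ ys) y ≡ headOr h ys
  next-head h y ys with y ≟ y
  ... | yes _   = refl
  ... | no  y≢y = ⊥-elim (y≢y refl)

  next-tail : ∀ h y ys {x} → x ≢ y → next h (y ∷ ys) x ≡ next h ys x
  next-tail h y ys {x} x≢y with x ≟ y
  ... | yes x≡y = ⊥-elim (x≢y x≡y)
  ... | no  _   = refl

  next-∈ : ∀ h xs x → next h xs x ∈ h ∷ xs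
  next-∈ h []       x = here refl
  next-∈ h (y ∷ ys) x = skip-y (by-cases (x ≟ y))
    where
    by-cases : (x≟y : Dec (x ≡ y)) → (if does x≟y then headOr h ys else next h ys x) ∈ h ∷ ys
    by-cases (yes _) = headOr-∈ h ys
    by-cases (no  _) = next-∈ h ys x
    skip-y : ∀ {z} → z ∈ h ∷ ys → z ∈ h ∷ y ∷ ys
    skip-y (here  z≡h) = here z≡h
    skip-y (there z∈)  = there (there z∈)

  next-iterates : ∀ {f : A → A} h xs → Unique xs → (∀ {x} → x ∈ xs → f x ≡ next h xs x) →
                  Iterates f (xs ∷ʳ h)
  next-iterates h []           _           _     = [-]
  next-iterates h (y ∷ [])     _           agree = trans (agree (here refl)) (next-head h y []) ∷ [-]
  next-iterates h (y ∷ z ∷ ys) (y∉ ∷ zys!) agree =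
    trans (agree (here refl)) (next-head h y (z ∷ ys)) ∷
    next-iterates h (z ∷ ys) zys!
      (λ x∈ → trans (agree (there x∈)) (next-tail h y (z ∷ ys) (λ x≡y → All.lookup y∉ x∈ (sym x≡y))))

  cycleSucc : A → List A → A → A
  cycleSucc m B = next m (m ∷ B)

  cycleSucc-∈ : ∀ m B x → cycleSucc m B x ∈ m ∷ B
  cycleSucc-∈ m B x with next-∈ m (m ∷ B) x
  ... | here  e = here e
  ... | there p = p

  cycleSucc-isCycle : ∀ {m B} → Unique (m ∷ B) → IsCycleOf (cycleSucc m B) m B
  cycleSucc-isCycle {m} {B} mB! = mB! , next-iterates m (m ∷ B) mB! (λ _ → refl)

  cycleSucc-agrees : ∀ {σ m B} → IsCycleOf σ m B → ∀ {x} → x ∈ m ∷ B → cycleSucc m B x ≡ σ x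
  cycleSucc-agrees {m = m} {B} (mB! , mB-iterates) x∈ =
    sym (iterates⇒related (m ∷ B) mB-iterates (proj₂ (cycleSucc-isCycle mB!)) x∈)

  cycleSucc-injective : ∀ {m B} → Unique (m ∷ B) → ∀ {x y} → x ∈ m ∷ B → y ∈ m ∷ B →
                        cycleSucc m B x ≡ cycleSucc m B y → x ≡ y
  cycleSucc-injective {m} {B} mB!@(m∉ ∷ B!) =
    unique-map⇒injectiveOn (cycleSucc m B)
      (subst Unique (sym (map-iterates m B (proj₂ (cycleSucc-isCycle mB!)))) Bm!)
    where
    Bm! : Unique (B ∷ʳ m)
    Bm! = unique-∷ʳ⁺ B! (λ m∈ → All.lookup m∉ m∈ refl)

  withCycle : A → List A → (A → A) → A → A
  withCycle m B f x with x ∈? m ∷ B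
  ... | yes _ = cycleSucc m B x
  ... | no  _ = f x

  module _ {m : A} {B : List A} {f : A → A} where

    withCycle-∈ : ∀ {x} → x ∈ m ∷ B → withCycle m B f x ≡ cycleSucc m B x
    withCycle-∈ {x} x∈ with x ∈? m ∷ B
    ... | yes _  = refl
    ... | no  x∉ = ⊥-elim (x∉ x∈)

    withCycle-∉ : ∀ {x} → x ∉ m ∷ B → withCycle m B f x ≡ f x
    withCycle-∉ {x} x∉ with x ∈? m ∷ B
    ... | yes x∈ = ⊥-elim (x∉ x∈)
    ... | no  _  = refl

    withCycle-isCycle : Unique (m ∷ B) → IsCycleOf (withCycle m B f) m B
    withCycle-isCycle mB! = mB! , next-iterates m (m ∷ B) mB! withCycle-∈

    withCycle-related : ∀ {R : A → A → Set} → Unique (m ∷ B) → Linked R (m ∷ B ∷ʳ m) →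
                        (∀ {x} → x ∉ m ∷ B → R x (f x)) → ∀ x → R x (withCycle m B f x)
    withCycle-related {R} mB! cycle-related outside-related x with x ∈? m ∷ B
    ... | yes x∈ = iterates⇒related (m ∷ B) cycle-related (proj₂ (cycleSucc-isCycle mB!)) x∈
    ... | no  x∉ = outside-related x∉

    withCycle-injective : Unique (m ∷ B) → (∀ {x y} → f x ≡ f y → x ≡ y) →
                          (∀ {x} → x ∉ m ∷ B → f x ∉ m ∷ B) →
                          ∀ {x y} → withCycle m B f x ≡ withCycle m B f y → x ≡ y
    withCycle-injective mB! f-injective f-outside {x} {y} eq with x ∈? m ∷ B | y ∈? m ∷ B
    ... | yes x∈ | yes y∈ = cycleSucc-injective mB! x∈ y∈ eq
    ... | yes _  | no  y∉ = ⊥-elim (f-outside y∉ (subst (_∈ m ∷ B) eq (cycleSucc-∈ m B x)))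
    ... | no  x∉ | yes _  = ⊥-elim (f-outside x∉ (subst (_∈ m ∷ B) (sym eq) (cycleSucc-∈ m B y)))
    ... | no  _  | no  _  = f-injective eq

  withCycle-≗⁻ : ∀ {m B B′ f g} → Unique (m ∷ B) → Unique (m ∷ B′) →
                 (∀ {x} → x ∈ m ∷ B → f x ≡ x) → (∀ {x} → x ∈ m ∷ B′ → g x ≡ x) →
                 (∀ x → withCycle m B f x ≡ withCycle m B′ g x) → B ≡ B′ × (∀ x → f x ≡ g x)
  withCycle-≗⁻ {m} {B} {B′} {f} {g} mB! mB′! f-fixes g-fixes agree = B≡B′ , f≗g
    where
    B≡B′ : B ≡ B′
    B≡B′ = iterates-unique m B B′
             (iterates-cong agree (proj₂ (withCycle-isCycle mB!))) (proj₂ (withCycle-isCycle mB′!))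
             (Unique[x∷xs]⇒x∉xs mB!) (Unique[x∷xs]⇒x∉xs mB′!)
    f≗g : ∀ x → f x ≡ g x
    f≗g x with x ∈? m ∷ B | x ∈? m ∷ B′
    ... | yes x∈ | yes x∈′ = trans (f-fixes x∈) (sym (g-fixes x∈′))
    ... | yes x∈ | no  x∉′ = ⊥-elim (x∉′ (subst (λ C → x ∈ m ∷ C) B≡B′ x∈))
    ... | no  x∉ | yes x∈′ = ⊥-elim (x∉ (subst (λ C → x ∈ m ∷ C) (sym B≡B′) x∈′))
    ... | no  x∉ | no  x∉′ = trans (sym (withCycle-∉ x∉)) (trans (agree x) (withCycle-∉ x∉′))

module Split {A : Set} (_≟_ : DecidableEquality A) where

  breakAt : A → List A → List A × List A
  breakAt m []       = [] , []
  breakAt m (x ∷ xs) with x ≟ m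
  ... | yes _ = [] , xs
  ... | no  _ = Product.map₁ (x ∷_) (breakAt m xs)

  breakAt-++ : ∀ {m} xs {ys} → m ∉ xs → breakAt m (xs ++ m ∷ ys) ≡ (xs , ys)
  breakAt-++ {m} [] m∉ with m ≟ m
  ... | yes _   = refl
  ... | no  m≢m = ⊥-elim (m≢m refl)
  breakAt-++ {m} (x ∷ xs) m∉ with x ≟ m
  ... | yes x≡m = ⊥-elim (m∉ (here (sym x≡m)))
  ... | no  _   = cong (Product.map₁ (x ∷_)) (breakAt-++ xs (m∉ ∘ there))

  first-occurrence : ∀ {m} xs → m ∈ xs → ∃₂ λ ys zs → xs ≡ ys ++ m ∷ zs × m ∉ ys
  first-occurrence {m} (x ∷ xs) m∈ with x ≟ m | m∈
  ... | yes refl | _          = [] , xs , refl , λ ()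
  ... | no  x≢m  | here m≡x   = ⊥-elim (x≢m (sym m≡x))
  ... | no  x≢m  | there m∈xs with first-occurrence xs m∈xs
  ...   | ys , zs , refl , m∉ys = x ∷ ys , zs , refl , λ { (here m≡x) → x≢m (sym m≡x) ; (there m∈) → m∉ys m∈ }

module _ {n : ℕ} where

  open import Data.List.Membership.DecPropositional (_≟ᶠ_ {n}) using (_∈?_)

  unique⇒length≤ : {xs : List (Fin n)} → Unique xs → length xs ≤ n
  unique⇒length≤ {xs} xs! = begin
    length xs                              ≡⟨ unique∧set⇒length≡ xs! (filter⁺ (_∈? xs) (allFin⁺ n)) xs≈ ⟩
    length (filter (_∈? xs) (allFin n))    ≤⟨ length-filter (_∈? xs) (allFin n) ⟩
    length (allFin n)                      ≡⟨ length-tabulate id ⟩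
    n                                      ∎
    where
    open ≤-Reasoning
    xs≈ : xs ∼[ set ] filter (_∈? xs) (allFin n)
    xs≈ = mk⇔ (λ x∈ → ∈-filter⁺ (_∈? xs) (∈-allFin _) x∈)
              (λ x∈ → proj₂ (∈-filter⁻ (_∈? xs) {xs = allFin n} x∈))

  unique∧length≡⇒∈ : {xs : List (Fin n)} → Unique xs → length xs ≡ n → ∀ v → v ∈ xs
  unique∧length≡⇒∈ {xs} xs! len v with v ∈? xs
  ... | yes v∈ = v∈
  ... | no  v∉ =
    ⊥-elim (<-irrefl refl (subst (λ l → suc l ≤ n) len (unique⇒length≤ (¬Any⇒All¬ xs v∉ ∷ xs!))))

  module _ {Inv : List (Fin n) → Set} {Goal : Set}
           (Inv⇒Unique : ∀ {W} → Inv W → Unique W)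
           (grow : ∀ {W} → Inv W → Goal ⊎ ∃ λ W′ → Inv W′ × length W < length W′)
           where

    bounded-growth : ∀ {W} → Inv W → Goal
    bounded-growth {W} = go (suc n) (s≤s (m≤m+n n (length W)))
      where
      go : ∀ k {W} → n < k + length W → Inv W → Goal
      go zero    lt inv = ⊥-elim (<⇒≱ lt (unique⇒length≤ (Inv⇒Unique inv)))
      go (suc k) {W} lt inv with grow inv
      ... | inj₁ goal               = goal
      ... | inj₂ (W′ , inv′ , W<W′) =
        go k (≤-trans lt (≤-trans (≤-reflexive (sym (+-suc k (length W)))) (+-monoʳ-≤ k W<W′))) inv′

  infixl 5 _∖_
  _∖_ : List (Fin n) → List (Fin n) → List (Fin n)
  S ∖ C = filter (λ x → ¬? (x ∈? C)) S

  module _ {S C : List (Fin n)} where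

    ∈-∖⁻ : ∀ {x} → x ∈ S ∖ C → x ∈ S × x ∉ C
    ∈-∖⁻ = ∈-filter⁻ (λ x → ¬? (x ∈? C)) {xs = S}

    ∈-∖⁺ : ∀ {x} → x ∈ S → x ∉ C → x ∈ S ∖ C
    ∈-∖⁺ = ∈-filter⁺ (λ x → ¬? (x ∈? C))

    ∖-unique : Unique S → Unique (S ∖ C)
    ∖-unique = filter⁺ (λ x → ¬? (x ∈? C))

    length-∖-< : ∀ {x} → x ∈ S → x ∈ C → length (S ∖ C) < length S
    length-∖-< x∈S x∈C =
      filter-notAll (λ x → ¬? (x ∈? C)) S (Any.map (λ x≡y y∉C → y∉C (subst (_∈ C) x≡y x∈C)) x∈S)

    ∖-++-∼set : ∀ {T} → (∀ {x} → x ∈ C → x ∈ S) → T ∼[ set ] S ∖ C → (T ++ C) ∼[ set ] S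
    ∖-++-∼set {T} C⊆S T≈S∖C = mk⇔ to from
      where
      to : ∀ {x} → x ∈ T ++ C → x ∈ S
      to x∈ with ∈-++⁻ T x∈
      ... | inj₁ x∈T = proj₁ (∈-∖⁻ (Equivalence.to T≈S∖C x∈T))
      ... | inj₂ x∈C = C⊆S x∈C
      from : ∀ {x} → x ∈ S → x ∈ T ++ C
      from {x} x∈S with x ∈? C
      ... | yes x∈C = ∈-++⁺ʳ T x∈C
      ... | no  x∉C = ∈-++⁺ˡ (Equivalence.from T≈S∖C (∈-∖⁺ x∈S x∉C))

  module _ {σ : Fin n → Fin n} (σ-injective : ∀ {x y} → σ x ≡ σ y → x ≡ y) where

    orbit : ∀ m → ∃ (IsCycleOf σ m)
    orbit m = bounded-growth (AllPairs.tail ∘ proj₁) extend ([] ∷ [] , [-])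
      where
      Segment : List (Fin n) → Set
      Segment W = Unique (m ∷ W) × Iterates σ (m ∷ W)
      extend : ∀ {W} → Segment W → ∃ (IsCycleOf σ m) ⊎ ∃ λ W′ → Segment W′ × length W < length W′
      extend {W} (mW! , it) with σ (lastOr m W) ≟ᶠ m | σ (lastOr m W) ∈? W
      ... | yes closes | _        =
        inj₁ (W , mW! , subst (λ z → Iterates σ (m ∷ W ∷ʳ z)) closes (iterates-∷ʳ⁺ W it))
      ... | no  _      | yes back = ⊥-elim (iterates-last-successor∉ σ-injective m W mW! it back)
      ... | no  ≢m     | no  ∉W   =
        inj₂ (W ∷ʳ σ (lastOr m W) , (unique-∷ʳ⁺ mW! fresh , iterates-∷ʳ⁺ W it) , length<length-++-∷ W)
        where
        fresh : σ (lastOr m W) ∉ m ∷ W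
        fresh (here  σlast≡m) = ≢m σlast≡m
        fresh (there σlast∈W) = ∉W σlast∈W

    ∖-cycle-closed : ∀ {S m B} → IsCycleOf σ m B → (∀ {x} → x ∈ S → σ x ∈ S) →
                     ∀ {x} → x ∈ S ∖ (m ∷ B) → σ x ∈ S ∖ (m ∷ B)
    ∖-cycle-closed {S} {m} {B} mB-cycle closed x∈ with ∈-∖⁻ {S} {m ∷ B} x∈
    ... | x∈S , x∉mB = ∈-∖⁺ (closed x∈S) (x∉mB ∘ cycle-preimage σ-injective mB-cycle)


module _ {A : Set} where

  toList-tabulate : ∀ {k} (f : Fin k → A) → toList (tabulate f) ≡ List.tabulate f
  toList-tabulate {zero}  f = refl
  toList-tabulate {suc k} f = cong (f Fin.zero ∷_) (toList-tabulate (f ∘ Fin.suc))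

  lookup∈toList : ∀ {k} (v : Vec A k) i → lookup v i ∈ toList v
  lookup∈toList (x ∷ᵥ v) Fin.zero    = here refl
  lookup∈toList (x ∷ᵥ v) (Fin.suc i) = there (lookup∈toList v i)

  lookup-injective : ∀ {k} (v : Vec A k) → Unique (toList v) → ∀ {i j} → lookup v i ≡ lookup v j → i ≡ j
  lookup-injective (x ∷ᵥ v) _        {Fin.zero}  {Fin.zero}  _ = refl
  lookup-injective (x ∷ᵥ v) (x∉ ∷ _) {Fin.zero}  {Fin.suc j} e = ⊥-elim (All.lookup x∉ (lookup∈toList v j) e)
  lookup-injective (x ∷ᵥ v) (x∉ ∷ _) {Fin.suc i} {Fin.zero}  e = ⊥-elim (All.lookup x∉ (lookup∈toList v i) (sym e))
  lookup-injective (x ∷ᵥ v) (_ ∷ v!) {Fin.suc i} {Fin.suc j} e = cong Fin.suc (lookup-injective v v! e)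

  concatMap-map : ∀ {B C : Set} (f : A → B → C) xs ys →
                  concatMap (λ x → map (f x) ys) xs ≡ cartesianProductWith f xs ys
  concatMap-map f []       ys = refl
  concatMap-map f (x ∷ xs) ys = cong (map (f x) ys ++_) (concatMap-map f xs ys)

module _ {n : ℕ} where

  ∈-allVecs : ∀ k (v : Vec (Fin n) k) → v ∈ allVecs n k
  ∈-allVecs zero    []ᵥ       = here refl
  ∈-allVecs (suc k) (x ∷ᵥ v) =
    subst (_ ∈_) (sym (concatMap-map _∷ᵥ_ (allFin n) (allVecs n k)))
      (∈-cartesianProductWith⁺ _∷ᵥ_ (∈-allFin x) (∈-allVecs k v))

  allVecs-unique : ∀ k → Unique (allVecs n k)
  allVecs-unique zero    = [] ∷ []
  allVecs-unique (suc k) =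
    subst Unique (sym (concatMap-map _∷ᵥ_ (allFin n) (allVecs n k)))
      (cartesianProductWith⁺ _∷ᵥ_ ∷-injective (allFin⁺ n) (allVecs-unique k))

  ∈-map-toList-allVecs : ∀ {k} (xs : List (Fin n)) → length xs ≡ k → xs ∈ map toList (allVecs n k)
  ∈-map-toList-allVecs xs refl =
    subst (_∈ map toList (allVecs n (length xs))) (toList∘fromList xs)
      (∈-map⁺ toList (∈-allVecs (length xs) (fromList xs)))

  map-toList-allVecs-unique : ∀ k → Unique (map toList (allVecs n k))
  map-toList-allVecs-unique k =
    Unique.map⁺ (λ {v} {w} eq → trans (sym (cast-is-id refl v)) (toList-injective refl v w eq))
      (allVecs-unique k)

module _ {n : ℕ} (D : Digraph n) where

  open import Data.List.Membership.DecPropositional (_≟ᶠ_ {n}) using (_∈?_)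
  open CycleSuccessor (_≟ᶠ_ {n})
  open Split (_≟ᶠ_ {n})

  private
    V : Set
    V = Fin n

  infix 4 _⇢_
  _⇢_ : V → V → Set
  _⇢_ = Arrow (complement D)

  ¬Arrow⇒⇢ : ∀ {u v} → ¬ Arrow D u v → u ⇢ v
  ¬Arrow⇒⇢ {u} {v} ¬uv with arrow D u v
  ... | true  = ⊥-elim (¬uv _)
  ... | false = _

  acyclic⇒loops : Acyclic D → ∀ v → v ⇢ v
  acyclic⇒loops acyclic v = ¬Arrow⇒⇢ (λ vv → acyclic v [] ([] ∷ [] , vv ∷ [-]))

  back-arrow⇒cycle : ∀ {h W x} → x ∈ h ∷ W → Arrow D x h → Unique (h ∷ W) → Linked (Arrow D) (h ∷ W) →
                     ∃ (IsCycle D h)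
  back-arrow⇒cycle (here refl) xh _ _ = [] , [] ∷ [] , xh ∷ [-]
  back-arrow⇒cycle {h} {x = x} (there x∈) xh hW! hW-linked with ∈-∃++ x∈
  ... | A , B , refl =
    A ∷ʳ x , unique-++⁻ˡ (h ∷ A ∷ʳ x) hAxB! , Linked-∷ʳ⁺ (h ∷ A) (Linked-++⁻ˡ (h ∷ A ∷ʳ x) hAxB-linked) xh
    where
    reassoc : h ∷ A ++ x ∷ B ≡ (h ∷ A ∷ʳ x) ++ B
    reassoc = cong (h ∷_) (sym (++-assoc A [ x ] B))
    hAxB! : Unique ((h ∷ A ∷ʳ x) ++ B)
    hAxB! = subst Unique reassoc hW!
    hAxB-linked : Linked (Arrow D) ((h ∷ A ∷ʳ x) ++ B)
    hAxB-linked = subst (Linked (Arrow D)) reassoc hW-linked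

  IsSource : List V → V → Set
  IsSource S v = v ∈ S × All (λ u → ¬ Arrow D u v) S

  isSource? : ∀ S v → Dec (IsSource S v)
  isSource? S v = (v ∈? S) ×-dec all? (λ u → ¬? (T? (arrow D u v))) S

  acyclic⇒source : Acyclic D → ∀ {S v} → v ∈ S → ∃ (IsSource S)
  acyclic⇒source acyclic {S} {v} v∈S with any? (isSource? S) S
  ... | yes found = let s , _ , s-source = find found in s , s-source
  ... | no  none  = ⊥-elim (bounded-growth proj₁ extend ([] , [] , []))
    where
    -- Without a source every vertex of S has a D-predecessor in S, so a backward D-path inside S can
    -- always be extended, and acyclicity forbids it from revisiting a vertex.
    predecessor : ∀ {h} → h ∈ S → ∃ λ u → u ∈ S × Arrow D u h
    predecessor {h} h∈S with any? (λ u → T? (arrow D u h)) S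
    ... | yes found    = find found
    ... | no  no-arrow = ⊥-elim (none (lose h∈S (h∈S , ¬Any⇒All¬ S no-arrow)))
    BackwardPath : List V → Set
    BackwardPath W = Unique W × Linked (Arrow D) W × All (_∈ S) W
    extend : ∀ {W} → BackwardPath W → ⊥ ⊎ ∃ λ W′ → BackwardPath W′ × length W < length W′
    extend {[]}    _ = inj₂ ([ v ] , ([] ∷ [] , [-] , v∈S ∷ []) , s≤s z≤n)
    extend {h ∷ W} (hW! , hW-linked , h∈S ∷ W⊆S) with predecessor h∈S
    ... | u , u∈S , uh with u ∈? h ∷ W
    ...   | yes u∈ = inj₁ (acyclic h _ (proj₂ (back-arrow⇒cycle u∈ uh hW! hW-linked)))
    ...   | no  u∉ = inj₂ (u ∷ h ∷ W , (¬Any⇒All¬ _ u∉ ∷ hW! , uh ∷ hW-linked , u∈S ∷ h∈S ∷ W⊆S) , ≤-refl)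

  source : List V → Maybe V
  source S = head (filter (isSource? S) (allFin n))

  source-sound : ∀ {S m} → source S ≡ just m → IsSource S m
  source-sound {S} eq with filter (isSource? S) (allFin n) in e
  source-sound {S} refl | m ∷ _ =
    proj₂ (∈-filter⁻ (isSource? S) {xs = allFin n} (subst (m ∈_) (sym e) (here refl)))

  source-complete : ∀ {S v} → IsSource S v → source S ≢ nothing
  source-complete {S} {v} v-source eq with filter (isSource? S) (allFin n) in e
  source-complete {S} {v} v-source eq | [] with subst (v ∈_) e (∈-filter⁺ (isSource? S) (∈-allFin v) v-source)
  ... | ()

  source-cong : ∀ {S S′} → S ∼[ set ] S′ → source S ≡ source S′
  source-cong {S} {S′} S≈S′ =
    cong head (filter-≐ (isSource? S) (isSource? S′)
      (transport (to S≈S′) (from S≈S′) , transport (from S≈S′) (to S≈S′)) (allFin n))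
    where
    open Equivalence
    transport : ∀ {S₁ S₂} → (∀ {x} → x ∈ S₁ → x ∈ S₂) → (∀ {x} → x ∈ S₂ → x ∈ S₁) →
                ∀ {v} → IsSource S₁ v → IsSource S₂ v
    transport S₁⊆S₂ S₂⊆S₁ (v∈ , no-arrow) = S₁⊆S₂ v∈ , All.tabulate (λ u∈ → All.lookup no-arrow (S₂⊆S₁ u∈))

  source≡nothing⇒[] : Acyclic D → ∀ {S} → source S ≡ nothing → S ≡ []
  source≡nothing⇒[] acyclic {[]}    _  = refl
  source≡nothing⇒[] acyclic {x ∷ S} eq =
    ⊥-elim (source-complete (proj₂ (acyclic⇒source acyclic (here refl))) eq)

  -- The fuel k bounds the number of cycles peeled off; k ≥ length xs suffices.
  pathPerm : ℕ → List V → V → V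
  pathPerm zero    xs = id
  pathPerm (suc k) xs =
    maybe (λ m → withCycle m (proj₂ (breakAt m xs)) (pathPerm k (proj₁ (breakAt m xs)))) id (source xs)

  pathPerm-sourceless : ∀ k {xs} → source xs ≡ nothing → ∀ x → pathPerm (suc k) xs x ≡ x
  pathPerm-sourceless k e x rewrite e = refl

  pathPerm-peel : ∀ k {A m B} → source (A ++ m ∷ B) ≡ just m → m ∉ A →
                  ∀ x → pathPerm (suc k) (A ++ m ∷ B) x ≡ withCycle m B (pathPerm k A) x
  pathPerm-peel k {A} {m} e m∉A x rewrite e =
    cong (λ (A′ , B′) → withCycle m B′ (pathPerm k A′) x) (breakAt-++ A m∉A)

  data Peeling : List V → Set where
    sourceless : ∀ {xs} → source xs ≡ nothing → Peeling xs
    peel       : ∀ A m B → source (A ++ m ∷ B) ≡ just m → m ∉ A → Peeling (A ++ m ∷ B)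

  peeling : ∀ xs → Peeling xs
  peeling xs with source xs in e
  ... | nothing = sourceless e
  ... | just m with first-occurrence xs (proj₁ (source-sound e))
  ...   | A , B , refl , m∉A = peel A m B e m∉A

  pathPerm-fixes : ∀ k xs {x} → x ∉ xs → pathPerm k xs x ≡ x
  pathPerm-fixes zero    _  _ = refl
  pathPerm-fixes (suc k) xs {x} x∉ with peeling xs
  ... | sourceless e        = pathPerm-sourceless k e x
  ... | peel A m B e m∉A = begin
    pathPerm (suc k) (A ++ m ∷ B) x  ≡⟨ pathPerm-peel k e m∉A x ⟩
    withCycle m B (pathPerm k A) x   ≡⟨ withCycle-∉ (x∉ ∘ ∈-++⁺ʳ A) ⟩
    pathPerm k A x                   ≡⟨ pathPerm-fixes k A (x∉ ∘ ∈-++⁺ˡ) ⟩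
    x                                ∎
    where open ≡-Reasoning

  pathPerm-∈ : ∀ k xs {x} → x ∈ xs → pathPerm k xs x ∈ xs
  pathPerm-∈ zero    _  x∈ = x∈
  pathPerm-∈ (suc k) xs {x} x∈ with peeling xs
  ... | sourceless e     = subst (_∈ xs) (sym (pathPerm-sourceless k e x)) x∈
  ... | peel A m B e m∉A =
    subst (_∈ A ++ m ∷ B) (sym (pathPerm-peel k e m∉A x)) (withCycle-∈-path (x ∈? m ∷ B))
    where
    withCycle-∈-path : Dec (x ∈ m ∷ B) → withCycle m B (pathPerm k A) x ∈ A ++ m ∷ B
    withCycle-∈-path (yes x∈mB) = subst (_∈ _) (sym (withCycle-∈ x∈mB)) (∈-++⁺ʳ A (cycleSucc-∈ m B x))
    withCycle-∈-path (no  x∉mB) with ∈-++⁻ A x∈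
    ... | inj₁ x∈A  = subst (_∈ _) (sym (withCycle-∉ x∉mB)) (∈-++⁺ˡ (pathPerm-∈ k A x∈A))
    ... | inj₂ x∈mB = ⊥-elim (x∉mB x∈mB)

  pathPerm-injective : ∀ k xs → Unique xs → ∀ {x y} → pathPerm k xs x ≡ pathPerm k xs y → x ≡ y
  pathPerm-injective zero    _  _ eq = eq
  pathPerm-injective (suc k) xs xs! {x} {y} eq with peeling xs
  ... | sourceless e =
    trans (sym (pathPerm-sourceless k e x)) (trans eq (pathPerm-sourceless k e y))
  ... | peel A m B e m∉A =
    withCycle-injective (unique-++⁻ʳ A xs!) (pathPerm-injective k A (unique-++⁻ˡ A xs!)) stays-outside
      (trans (sym (pathPerm-peel k e m∉A x)) (trans eq (pathPerm-peel k e m∉A y)))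
    where
    stays-outside : ∀ {z} → z ∉ m ∷ B → pathPerm k A z ∉ m ∷ B
    stays-outside {z} z∉mB with z ∈? A
    ... | yes z∈A = λ fz∈mB → unique-++⇒disjoint A xs! (pathPerm-∈ k A z∈A , fz∈mB)
    ... | no  z∉A = subst (_∉ m ∷ B) (sym (pathPerm-fixes k A z∉A)) z∉mB

  pathPerm-⇢ : Acyclic D → ∀ k xs → Unique xs → Linked _⇢_ xs → ∀ x → x ⇢ pathPerm k xs x
  pathPerm-⇢ acyclic zero    _  _   _         x = acyclic⇒loops acyclic x
  pathPerm-⇢ acyclic (suc k) xs xs! xs-linked x with peeling xs
  ... | sourceless e     = subst (x ⇢_) (sym (pathPerm-sourceless k e x)) (acyclic⇒loops acyclic x)
  ... | peel A m B e m∉A =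
    subst (x ⇢_) (sym (pathPerm-peel k e m∉A x))
      (withCycle-related (unique-++⁻ʳ A xs!) cycle-linked
        (λ _ → pathPerm-⇢ acyclic k A (unique-++⁻ˡ A xs!) (Linked-++⁻ˡ A xs-linked) _) x)
    where
    into-m : ∀ {z} → z ∈ A ++ m ∷ B → z ⇢ m
    into-m z∈ = ¬Arrow⇒⇢ (All.lookup (proj₂ (source-sound e)) z∈)
    cycle-linked : Linked _⇢_ (m ∷ B ∷ʳ m)
    cycle-linked = Linked-++-All⁺ (Linked-++⁻ʳ A xs-linked) (All.tabulate (into-m ∘ ∈-++⁺ʳ A)) [-]

  pathPerm-fixes-++ : ∀ k A {C x} → Unique (A ++ C) → x ∈ C → pathPerm k A x ≡ x
  pathPerm-fixes-++ k A AC! x∈C = pathPerm-fixes k A (λ x∈A → unique-++⇒disjoint A AC! (x∈A , x∈C))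

  pathPerm-determines-path : Acyclic D → ∀ k {xs ys} → Unique xs → Unique ys → length xs ≤ k →
                             xs ∼[ set ] ys → (∀ x → pathPerm k xs x ≡ pathPerm k ys x) → xs ≡ ys
  pathPerm-determines-path acyclic zero {[]} _ _ _ xs≈ys _ = sym (⊆[]⇒≡[] (Equivalence.from xs≈ys))
  pathPerm-determines-path acyclic (suc k) {xs} {ys} xs! ys! len xs≈ys agree with peeling xs | peeling ys
  ... | sourceless e | _ with source≡nothing⇒[] acyclic e
  ...   | refl = sym (⊆[]⇒≡[] (Equivalence.from xs≈ys))
  pathPerm-determines-path acyclic (suc k) xs! ys! len xs≈ys agree | peel A m B e _ | sourceless e′
    with trans (sym e) (trans (source-cong xs≈ys) e′)
  ... | ()
  pathPerm-determines-path acyclic (suc k) xs! ys! len xs≈ys agree | peel A m B e m∉A | peel A′ m′ B′ e′ m′∉A′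
    with just-injective (trans (sym e) (trans (source-cong xs≈ys) e′))
  ... | refl
    with withCycle-≗⁻ (unique-++⁻ʳ A xs!) (unique-++⁻ʳ A′ ys!)
           (pathPerm-fixes-++ k A xs!) (pathPerm-fixes-++ k A′ ys!)
           (λ x → trans (sym (pathPerm-peel k e m∉A x)) (trans (agree x) (pathPerm-peel k e′ m′∉A′ x)))
  ...   | refl , A-agree =
    cong (_++ m ∷ B) (pathPerm-determines-path acyclic k (unique-++⁻ˡ A xs!) (unique-++⁻ˡ A′ ys!)
      (≤-pred (≤-trans (length<length-++-∷ A) len))
      (∼set-++-cancelʳ (unique-++⇒disjoint A xs!) (unique-++⇒disjoint A′ ys!) xs≈ys) A-agree)

  module _ {σ : V → V} (σ-injective : ∀ {x y} → σ x ≡ σ y → x ≡ y) (σ-⇢ : ∀ x → x ⇢ σ x) where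

    record Realisation (k : ℕ) (S : List V) : Set where
      field
        path     : List V
        unique   : Unique path
        linked   : Linked _⇢_ path
        vertices : path ∼[ set ] S
        realises : ∀ {x} → x ∈ S → pathPerm k path x ≡ σ x

    empty-realisation : ∀ {k} → Realisation k []
    empty-realisation =
      record { path = [] ; unique = [] ; linked = [] ; vertices = mk⇔ id id ; realises = λ () }

    realise : Acyclic D → ∀ k {S} → Unique S → length S ≤ k → (∀ {x} → x ∈ S → σ x ∈ S) → Realisation k S
    realise-from-source : Acyclic D → ∀ k {S m} → source S ≡ just m → Unique S → length S ≤ suc k →
                          (∀ {x} → x ∈ S → σ x ∈ S) → Realisation (suc k) S

    realise acyclic zero {[]} _ _ _ = empty-realisation
    realise acyclic (suc k) {S} S! len closed with source S in e
    ... | just m  = realise-from-source acyclic k e S! len closed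
    ... | nothing with source≡nothing⇒[] acyclic e
    ...   | refl = empty-realisation

    realise-from-source acyclic k {S} {m} e S! len closed = record
      { path     = IH.path ++ m ∷ B
      ; unique   = Unique.++⁺ IH.unique mB! (λ (x∈ , x∈mB) → proj₂ (on-path x∈) x∈mB)
      ; linked   = Linked-++-All⁺ IH.linked (All.tabulate (into-m ∘ proj₁ ∘ on-path)) cycle-linked
      ; vertices = vertices
      ; realises = realises
      }
      where
      B : List V
      B = proj₁ (orbit σ-injective m)
      mB-cycle : IsCycleOf σ m B
      mB-cycle = proj₂ (orbit σ-injective m)
      mB! : Unique (m ∷ B)
      mB! = proj₁ mB-cycle
      m∈S : m ∈ S
      m∈S = proj₁ (source-sound e)
      into-m : ∀ {x} → x ∈ S → x ⇢ m
      into-m x∈ = ¬Arrow⇒⇢ (All.lookup (proj₂ (source-sound e)) x∈)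
      mB⊆S : ∀ {x} → x ∈ m ∷ B → x ∈ S
      mB⊆S = All.lookup (All.++⁻ˡ (m ∷ B) (iterates-closed closed m∈S (proj₂ mB-cycle)))
      module IH = Realisation
        (realise acyclic k (∖-unique S!) (≤-pred (≤-trans (length-∖-< m∈S (here refl)) len))
          (∖-cycle-closed σ-injective mB-cycle closed))
      on-path : ∀ {x} → x ∈ IH.path → x ∈ S × x ∉ m ∷ B
      on-path = ∈-∖⁻ {S = S} {C = m ∷ B} ∘ Equivalence.to IH.vertices
      cycle-linked : Linked _⇢_ (m ∷ B)
      cycle-linked = Linked.map (λ {x} σx≡y → subst (x ⇢_) σx≡y (σ-⇢ x)) (Linked-++⁻ˡ (m ∷ B) (proj₂ mB-cycle))
      vertices : (IH.path ++ m ∷ B) ∼[ set ] S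
      vertices = ∖-++-∼set mB⊆S IH.vertices
      realises : ∀ {x} → x ∈ S → pathPerm (suc k) (IH.path ++ m ∷ B) x ≡ σ x
      realises {x} x∈ = begin
        pathPerm (suc k) (IH.path ++ m ∷ B) x  ≡⟨ pathPerm-peel k (trans (source-cong vertices) e) m∉path x ⟩
        withCycle m B (pathPerm k IH.path) x   ≡⟨ on-cycle? (x ∈? m ∷ B) ⟩
        σ x                                    ∎
        where
        open ≡-Reasoning
        m∉path : m ∉ IH.path
        m∉path m∈ = proj₂ (on-path m∈) (here refl)
        on-cycle? : Dec (x ∈ m ∷ B) → withCycle m B (pathPerm k IH.path) x ≡ σ x
        on-cycle? (yes x∈mB) = trans (withCycle-∈ x∈mB) (cycleSucc-agrees mB-cycle x∈mB)
        on-cycle? (no  x∉mB) = trans (withCycle-∉ x∉mB) (IH.realises (∈-∖⁺ x∈ x∉mB))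

  toCycleCover : List V → Vec V n
  toCycleCover xs = tabulate (pathPerm n xs)

  lookup-toCycleCover : ∀ xs v → lookup (toCycleCover xs) v ≡ pathPerm n xs v
  lookup-toCycleCover xs = lookup∘tabulate (pathPerm n xs)

  toCycleCover-isCycleCover : Acyclic D → ∀ {xs} → IsHamiltonianPath (complement D) xs →
                              IsCycleCover (complement D) (toCycleCover xs)
  toCycleCover-isCycleCover acyclic {xs} (_ , xs! , xs-linked) =
    subst Unique (sym (toList-tabulate (pathPerm n xs))) (tabulate⁺ (pathPerm-injective n xs xs!)) ,
    λ v → subst (v ⇢_) (sym (lookup-toCycleCover xs v)) (pathPerm-⇢ acyclic n xs xs! xs-linked v)

  toCycleCover-injective : Acyclic D → ∀ {xs ys} → IsHamiltonianPath (complement D) xs →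
                           IsHamiltonianPath (complement D) ys → toCycleCover xs ≡ toCycleCover ys → xs ≡ ys
  toCycleCover-injective acyclic {xs} {ys} (xs-length , xs! , _) (ys-length , ys! , _) eq =
    pathPerm-determines-path acyclic n xs! ys! (≤-reflexive xs-length)
      (mk⇔ (λ _ → unique∧length≡⇒∈ ys! ys-length _) (λ _ → unique∧length≡⇒∈ xs! xs-length _))
      (λ v → begin
        pathPerm n xs v             ≡⟨ lookup-toCycleCover xs v ⟨
        lookup (toCycleCover xs) v  ≡⟨ cong (λ σ → lookup σ v) eq ⟩
        lookup (toCycleCover ys) v  ≡⟨ lookup-toCycleCover ys v ⟩
        pathPerm n ys v             ∎)
    where open ≡-Reasoning

  toCycleCover-surjective : Acyclic D → ∀ {σ} → IsCycleCover (complement D) σ →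
                            ∃ λ xs → IsHamiltonianPath (complement D) xs × toCycleCover xs ≡ σ
  toCycleCover-surjective acyclic {σ} (σ! , σ-⇢) =
    R.path , (path-length , R.unique , R.linked) ,
    trans (tabulate-cong (λ v → R.realises (∈-allFin v))) (tabulate∘lookup σ)
    where
    module R = Realisation
      (realise (lookup-injective σ σ!) σ-⇢ acyclic n (allFin⁺ n) (≤-reflexive (length-tabulate id))
        (λ _ → ∈-allFin _))
    path-length : length R.path ≡ n
    path-length = trans (unique∧set⇒length≡ R.unique (allFin⁺ n) R.vertices) (length-tabulate id)

theorem2p1 : (n : ℕ) (D : Digraph n) → Acyclic D →
    numHamiltonianPaths (complement D) ≡ numCycleCovers (complement D)
theorem2p1 n D acyclic =
  bijection⇒length-filter≡ (isHamiltonianPath? (complement D)) (isCycleCover? (complement D)) (toCycleCover D)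
    (map-toList-allVecs-unique n) (allVecs-unique n)
    (λ (xs-length , _) → ∈-map-toList-allVecs _ xs-length) (λ {σ} _ → ∈-allVecs n σ)
    (toCycleCover-isCycleCover D acyclic) (toCycleCover-injective D acyclic) (toCycleCover-surjective D acyclic)
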